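{- Let $k\geq 1$, $n\geq 2k+1$, $r\geq 2$ be integers and $\Omega=\{1,\ldots,n+k(r-2)\}$. The symmetric group $S_\Omega$, acting on the elements of $\Gamma(KG(n,k),r)$ by applying a permutation to each $k$-subset within its copy, acts transitively on the chambers of $\Gamma(KG(n,k),r)$; in other words, $\Gamma(KG(n,k),r)$ is flag-transitive.
   Context: Let $I=\{1,\ldots,r\}$. The incidence system $\Gamma(KG(n,k),r)=(X,*,t,I)$ has element set $X=X_1\cup\cdots\cup X_r$, a disjoint union of $r$ copies of the set of all $k$-subsets of $\Omega$; $t(x)=i$ for $x\in X_i$; $x\in X_i$ and $y\in X_j$ are incident iff $x=y$ or ($i\neq j$ and $x\cap y=\emptyset$ as subsets of $\Omega$). A flag is a set of pairwise incident elements, its type is the set of types of its elements, a chamber is a flag of type $I$. A type-preserving automorphism is a bijection of $X$ preserving incidence and types; the incidence system is flag-transitive if the group of type-preserving automorphisms is transitive on the set of flags of type $J$ for every $J\subseteq I$. -}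

module Defs where

open import Data.Nat using (ℕ; _+_; _*_; _∸_)
open import Data.Fin using (Fin)
open import Data.Fin.Subset using (Subset; _∩_; ⊥; ∣_∣; _∈_)
open import Data.Fin.Permutation using (Permutation′; _⟨$⟩ˡ_)
open import Data.Vec using (tabulate; lookup)
open import Data.Product using (Σ; ∃; _×_; _,_; proj₁; proj₂)
open import Data.Sum using (_⊎_)
open import Function.Bundles using (_⇔_)
open import Relation.Binary.PropositionalEquality using (_≡_; _≢_)

-- Ω = {1,…,N} is modelled by Fin N.
-- Raw elements: a copy index i ∈ I = Fin r together with a subset of Ω.
-- The element set X of Γ(KG(n,k),r) consists of the raw elements whose
-- subset has exactly k elements (predicate IsElem).
Raw : ℕ → ℕ → Set
Raw N r = Fin r × Subset N

module Incidence {N r : ℕ} (k : ℕ) where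

  IsElem : Raw N r → Set
  IsElem (_ , s) = ∣ s ∣ ≡ k

  typ : Raw N r → Fin r
  typ = proj₁

  Incident : Raw N r → Raw N r → Set
  Incident x y = x ≡ y ⊎ (proj₁ x ≢ proj₁ y × (proj₂ x ∩ proj₂ y) ≡ ⊥)

  ElemSet : Set₁
  ElemSet = Raw N r → Set

  IsFlag : ElemSet → Set
  IsFlag F = (∀ x → F x → IsElem x) × (∀ x y → F x → F y → Incident x y)

  HasType : ElemSet → Subset r → Set
  HasType F J = ∀ i → (i ∈ J ⇔ ∃ λ s → F (i , s))

  IsFlagOfType : Subset r → ElemSet → Set
  IsFlagOfType J F = IsFlag F × HasType F J

  IsChamber : ElemSet → Set
  IsChamber F = IsFlag F × (∀ i → ∃ λ s → F (i , s))

  Image : (Raw N r → Raw N r) → ElemSet → ElemSet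
  Image g F x = ∃ λ y → F y × g y ≡ x

  record IsTPAut (g : Raw N r → Raw N r) : Set where
    field
      inv       : Raw N r → Raw N r
      g-elem    : ∀ x → IsElem x → IsElem (g x)
      inv-elem  : ∀ x → IsElem x → IsElem (inv x)
      inv-g     : ∀ x → IsElem x → inv (g x) ≡ x
      g-inv     : ∀ x → IsElem x → g (inv x) ≡ x
      type-pres : ∀ x → IsElem x → typ (g x) ≡ typ x
      inc-pres  : ∀ x y → IsElem x → IsElem y → (Incident x y ⇔ Incident (g x) (g y))

  FlagTransitive : Set₁
  FlagTransitive = ∀ (J : Subset r) (F F′ : ElemSet) →
    IsFlagOfType J F → IsFlagOfType J F′ →
    ∃ λ g → IsTPAut g × (∀ x → F′ x ⇔ Image g F x)

-- action of a permutation π of Ω on subsets: π·s = { π(a) : a ∈ s }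
permSet : {N : ℕ} → Permutation′ N → Subset N → Subset N
permSet π s = tabulate (λ j → lookup s (π ⟨$⟩ˡ j))

permAct : {N r : ℕ} → Permutation′ N → Raw N r → Raw N r
permAct π (i , s) = (i , permSet π s)

omegaSize : ℕ → ℕ → ℕ → ℕ
omegaSize n k r = n + k * (r ∸ 2)

-- In a flag each type occurs at most once and elements of distinct types are
-- disjoint, so a flag of type J is a family, indexed by J, of pairwise disjoint
-- k-subsets of Ω. Listing the elements of such a family block by block gives a
-- duplicate-free list, and S_Ω acts transitively on duplicate-free lists of a
-- given length (extend a permutation by one transposition per entry). A
-- permutation carrying the list of one flag to that of another flag of the same
-- type carries the blocks type by type, and it acts on Γ as a type-preserving
-- automorphism.
module Submission where

open import Defs
open import Data.Nat using (ℕ; zero; suc; _≤_; _+_; _*_)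
open import Data.Nat.Properties using (suc-injective; +-0-commutativeMonoid)
open import Data.Bool using (Bool)
open import Data.Empty using (⊥; ⊥-elim)
open import Data.Fin using (Fin; zero; suc)
open import Data.Fin.Properties using (_≟_) renaming (suc-injective to Fin-suc-injective)
open import Data.Fin.Subset using (Subset; inside; outside; ∣_∣; _∩_; _∈_) renaming (⊥ to ∅)
open import Data.Fin.Subset.Properties using (∉⊥; x∈p∩q⁺; x∈p∩q⁻; ⊆-antisym; _∈?_)
open import Data.Fin.Permutation using (Permutation′; _⟨$⟩ʳ_; _⟨$⟩ˡ_; _∘ₚ_; transpose; flip; inverseˡ; inverseʳ) renaming (id to idₚ)
import Data.Fin.Permutation.Components as PC
open import Data.Vec using ([]; _∷_; here; there; lookup)
open import Data.Vec.Properties using (lookup∘tabulate; []=⇒lookup; lookup⇒[]=)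
open import Data.List using (List; []; _∷_; map; length; _++_)
open import Data.List.Properties using (∷-injective; map-++; map-∘; map-id-local; length-map; length-++)
open import Data.List.Membership.Propositional using () renaming (_∈_ to _∈ₗ_)
open import Data.List.Membership.Propositional.Properties using (∈-map⁺; ∈-map⁻; ∈-++⁻)
open import Data.List.Relation.Unary.All using (All)
import Data.List.Relation.Unary.All as All
import Data.List.Relation.Unary.All.Properties as All
open import Data.List.Relation.Unary.AllPairs using ([]; _∷_)
open import Data.List.Relation.Unary.Any using (here; there)
open import Data.List.Relation.Unary.Unique.Propositional using (Unique)
import Data.List.Relation.Unary.Unique.Propositional.Properties as Unique
open import Algebra.Properties.CommutativeMonoid.Sum +-0-commutativeMonoid using (sum; sum-permute; sum-cong-≗)
open import Data.Product using (∃; _×_; _,_; proj₁; proj₂)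
open import Data.Sum using (inj₁; inj₂)
open import Function using (_∘_)
open import Function.Bundles using (_⇔_; mk⇔; Equivalence)
open import Relation.Nullary using (¬_; yes; no)
open import Relation.Binary.PropositionalEquality

private
  variable
    m N : ℕ

elems : Subset N → List (Fin N)
elems []            = []
elems (inside  ∷ p) = zero ∷ map suc (elems p)
elems (outside ∷ p) = map suc (elems p)

∈-elems⁺ : ∀ {x} (p : Subset N) → x ∈ p → x ∈ₗ elems p
∈-elems⁺ (inside  ∷ p) here       = here refl
∈-elems⁺ (inside  ∷ p) (there x∈) = there (∈-map⁺ suc (∈-elems⁺ p x∈))
∈-elems⁺ (outside ∷ p) (there x∈) = ∈-map⁺ suc (∈-elems⁺ p x∈)

∈-elems⁻ : ∀ {x} (p : Subset N) → x ∈ₗ elems p → x ∈ p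
∈-elems⁻ (inside ∷ p) (here refl) = here
∈-elems⁻ (inside ∷ p) (there x∈) with ∈-map⁻ suc x∈
... | _ , y , refl = there (∈-elems⁻ p y)
∈-elems⁻ (outside ∷ p) x∈ with ∈-map⁻ suc x∈
... | _ , y , refl = there (∈-elems⁻ p y)

elems-Unique : (p : Subset N) → Unique (elems p)
elems-Unique []            = []
elems-Unique (inside  ∷ p) = All.map⁺ (All.universal (λ _ ()) (elems p)) ∷ Unique.map⁺ Fin-suc-injective (elems-Unique p)
elems-Unique (outside ∷ p) = Unique.map⁺ Fin-suc-injective (elems-Unique p)

length-elems : (p : Subset N) → length (elems p) ≡ ∣ p ∣
length-elems []            = refl
length-elems (inside  ∷ p) = cong suc (trans (length-map suc (elems p)) (length-elems p))
length-elems (outside ∷ p) = trans (length-map suc (elems p)) (length-elems p)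

length-elems-cong : (p q : Subset N) → ∣ p ∣ ≡ ∣ q ∣ → length (elems p) ≡ length (elems q)
length-elems-cong p q eq = trans (length-elems p) (trans eq (sym (length-elems q)))

transpose-matchˡ : (i j : Fin N) → PC.transpose i j i ≡ j
transpose-matchˡ i j with i ≟ i
... | yes _  = refl
... | no i≢i = ⊥-elim (i≢i refl)

transpose-fixes : {i j k : Fin N} → i ≢ k → j ≢ k → PC.transpose i j k ≡ k
transpose-fixes {i = i} {j} {k} i≢k j≢k with k ≟ i
... | yes k≡i = ⊥-elim (i≢k (sym k≡i))
... | no _ with k ≟ j
...   | yes k≡j = ⊥-elim (j≢k (sym k≡j))
...   | no _    = refl

⟨$⟩ʳ-injective : (π : Permutation′ N) {a b : Fin N} → π ⟨$⟩ʳ a ≡ π ⟨$⟩ʳ b → a ≡ b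
⟨$⟩ʳ-injective π eq = trans (sym (inverseˡ π)) (trans (cong (π ⟨$⟩ˡ_) eq) (inverseˡ π))

-- π is extended to x by postcomposing with the transposition (π x  y); it fixes
-- the images of the other entries since both π x and y are missing from them.
Unique-conjugate : {xs ys : List (Fin N)} → Unique xs → Unique ys → length xs ≡ length ys →
  ∃ λ (π : Permutation′ N) → map (π ⟨$⟩ʳ_) xs ≡ ys
Unique-conjugate {xs = []} {[]} _ _ _ = idₚ , refl
Unique-conjugate {xs = x ∷ xs} {y ∷ ys} (x∉xs ∷ xs!) (y∉ys ∷ ys!) eq
  with Unique-conjugate xs! ys! (suc-injective eq)
... | π , πxs≡ys = π ∘ₚ transpose (π ⟨$⟩ʳ x) y , cong₂ _∷_ (transpose-matchˡ (π ⟨$⟩ʳ x) y) τπxs≡ys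
  where
  open ≡-Reasoning
  τ : Fin _ → Fin _
  τ = PC.transpose (π ⟨$⟩ʳ x) y
  πx∉ys : All (π ⟨$⟩ʳ x ≢_) ys
  πx∉ys = subst (All _) πxs≡ys (All.map⁺ (All.map (λ x≢z → x≢z ∘ ⟨$⟩ʳ-injective π) x∉xs))
  τπxs≡ys : map (τ ∘ (π ⟨$⟩ʳ_)) xs ≡ ys
  τπxs≡ys = begin
    map (τ ∘ (π ⟨$⟩ʳ_)) xs  ≡⟨ map-∘ xs ⟩
    map τ (map (π ⟨$⟩ʳ_) xs) ≡⟨ cong (map τ) πxs≡ys ⟩
    map τ ys                ≡⟨ map-id-local (All.zipWith (λ (a , b) → transpose-fixes a b) (πx∉ys , y∉ys)) ⟩
    ys                      ∎

++-cancel-length : {A : Set} (as cs : List A) {bs ds : List A} →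
  length as ≡ length cs → as ++ bs ≡ cs ++ ds → as ≡ cs × bs ≡ ds
++-cancel-length []       []       _   eq = refl , eq
++-cancel-length (a ∷ as) (c ∷ cs) len eq with ∷-injective eq
... | refl , eq′ with ++-cancel-length as cs (suc-injective len) eq′
...   | refl , bs≡ds = refl , bs≡ds

module _ (π : Permutation′ N) where

  ∈-permSet⁻ : ∀ {s x} → x ∈ permSet π s → π ⟨$⟩ˡ x ∈ s
  ∈-permSet⁻ {s} {x} x∈ = lookup⇒[]= _ s (trans (sym (lookup∘tabulate _ x)) ([]=⇒lookup x∈))

  ∈-permSet⁺ : ∀ {s x} → π ⟨$⟩ˡ x ∈ s → x ∈ permSet π s
  ∈-permSet⁺ {s} {x} πx∈ = lookup⇒[]= x _ (trans (lookup∘tabulate _ x) ([]=⇒lookup πx∈))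

  permSet-elems : {s t : Subset N} → map (π ⟨$⟩ʳ_) (elems s) ≡ elems t → permSet π s ≡ t
  permSet-elems {s} {t} eq = ⊆-antisym to from
    where
    to : ∀ {x} → x ∈ permSet π s → x ∈ t
    to x∈ = subst (_∈ t) (inverseʳ π)
      (∈-elems⁻ t (subst (_ ∈ₗ_) eq (∈-map⁺ (π ⟨$⟩ʳ_) (∈-elems⁺ s (∈-permSet⁻ x∈)))))
    from : ∀ {x} → x ∈ t → x ∈ permSet π s
    from x∈ with ∈-map⁻ (π ⟨$⟩ʳ_) (subst (_ ∈ₗ_) (sym eq) (∈-elems⁺ t x∈))
    ... | y , y∈ , refl = ∈-permSet⁺ (subst (_∈ s) (sym (inverseˡ π)) (∈-elems⁻ s y∈))

  permSet-∩ : (s t : Subset N) → permSet π (s ∩ t) ≡ permSet π s ∩ permSet π t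
  permSet-∩ s t = ⊆-antisym
    (λ x∈ → let (x∈s , x∈t) = x∈p∩q⁻ s t (∈-permSet⁻ x∈) in x∈p∩q⁺ (∈-permSet⁺ x∈s , ∈-permSet⁺ x∈t))
    (λ x∈ → let (x∈s , x∈t) = x∈p∩q⁻ (permSet π s) (permSet π t) x∈ in
      ∈-permSet⁺ {s ∩ t} (x∈p∩q⁺ (∈-permSet⁻ {s} x∈s , ∈-permSet⁻ {t} x∈t)))

  permSet-∅ : permSet π ∅ ≡ ∅
  permSet-∅ = ⊆-antisym (λ x∈ → ⊥-elim (∉⊥ (∈-permSet⁻ x∈))) (λ x∈ → ⊥-elim (∉⊥ x∈))

permSet-inverseˡ : (π : Permutation′ N) (s : Subset N) → permSet (flip π) (permSet π s) ≡ s
permSet-inverseˡ π s = ⊆-antisym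
  (λ x∈ → subst (_∈ s) (inverseˡ π) (∈-permSet⁻ π (∈-permSet⁻ (flip π) x∈)))
  (λ x∈ → ∈-permSet⁺ (flip π) (∈-permSet⁺ π (subst (_∈ s) (sym (inverseˡ π)) x∈)))

indicator : Bool → ℕ
indicator inside  = 1
indicator outside = 0

∣p∣≡sum-indicator : (p : Subset N) → ∣ p ∣ ≡ sum (indicator ∘ lookup p)
∣p∣≡sum-indicator []            = refl
∣p∣≡sum-indicator (inside  ∷ p) = cong suc (∣p∣≡sum-indicator p)
∣p∣≡sum-indicator (outside ∷ p) = ∣p∣≡sum-indicator p

∣permSet∣ : (π : Permutation′ N) (s : Subset N) → ∣ permSet π s ∣ ≡ ∣ s ∣
∣permSet∣ π s = begin
  ∣ permSet π s ∣                              ≡⟨ ∣p∣≡sum-indicator (permSet π s) ⟩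
  sum (indicator ∘ lookup (permSet π s))        ≡⟨ sum-cong-≗ (cong indicator ∘ lookup∘tabulate (lookup s ∘ (π ⟨$⟩ˡ_))) ⟩
  sum (indicator ∘ lookup s ∘ (flip π ⟨$⟩ʳ_))    ≡⟨ sym (sum-permute (indicator ∘ lookup s) (flip π)) ⟩
  sum (indicator ∘ lookup s)                    ≡⟨ sym (∣p∣≡sum-indicator s) ⟩
  ∣ s ∣                                         ∎
  where open ≡-Reasoning

PairwiseDisjoint : (Fin m → Subset N) → Set
PairwiseDisjoint S = ∀ {i j x} → i ≢ j → x ∈ S i → x ∈ S j → ⊥

concatElems : (Fin m → Subset N) → List (Fin N)
concatElems {zero}  S = []
concatElems {suc m} S = elems (S zero) ++ concatElems (S ∘ suc)

∈-concatElems⁻ : (S : Fin m → Subset N) {x : Fin N} → x ∈ₗ concatElems S → ∃ λ i → x ∈ S i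
∈-concatElems⁻ {suc m} S x∈ with ∈-++⁻ (elems (S zero)) x∈
... | inj₁ x∈S₀ = zero , ∈-elems⁻ (S zero) x∈S₀
... | inj₂ x∈Sₛ with ∈-concatElems⁻ (S ∘ suc) x∈Sₛ
...   | i , x∈Sᵢ = suc i , x∈Sᵢ

concatElems-Unique : (S : Fin m → Subset N) → PairwiseDisjoint S → Unique (concatElems S)
concatElems-Unique {zero}  S _        = []
concatElems-Unique {suc m} S disjoint = Unique.++⁺ (elems-Unique (S zero))
  (concatElems-Unique (S ∘ suc) (λ i≢j → disjoint (i≢j ∘ Fin-suc-injective)))
  λ (x∈S₀ , x∈Sₛ) → let (i , x∈Sᵢ) = ∈-concatElems⁻ (S ∘ suc) x∈Sₛ in
    disjoint (λ ()) (∈-elems⁻ (S zero) x∈S₀) x∈Sᵢ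

length-concatElems-cong : (S S′ : Fin m → Subset N) → (∀ i → ∣ S i ∣ ≡ ∣ S′ i ∣) →
  length (concatElems S) ≡ length (concatElems S′)
length-concatElems-cong {zero}  S S′ _     = refl
length-concatElems-cong {suc m} S S′ sizes = begin
  length (elems (S zero) ++ concatElems (S ∘ suc))                 ≡⟨ length-++ (elems (S zero)) ⟩
  length (elems (S zero)) + length (concatElems (S ∘ suc))         ≡⟨ cong₂ _+_ (length-elems-cong (S zero) (S′ zero) (sizes zero))
                                                                         (length-concatElems-cong (S ∘ suc) (S′ ∘ suc) (sizes ∘ suc)) ⟩
  length (elems (S′ zero)) + length (concatElems (S′ ∘ suc))       ≡⟨ length-++ (elems (S′ zero)) ⟨
  length (elems (S′ zero) ++ concatElems (S′ ∘ suc))               ∎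
  where open ≡-Reasoning

map-concatElems-split : (f : Fin N → Fin N) (S S′ : Fin (suc m) → Subset N) → ∣ S zero ∣ ≡ ∣ S′ zero ∣ →
  map f (concatElems S) ≡ concatElems S′ →
  map f (elems (S zero)) ≡ elems (S′ zero) × map f (concatElems (S ∘ suc)) ≡ concatElems (S′ ∘ suc)
map-concatElems-split f S S′ size₀ eq = ++-cancel-length (map f (elems (S zero))) (elems (S′ zero))
  (trans (length-map f (elems (S zero))) (length-elems-cong (S zero) (S′ zero) size₀))
  (trans (sym (map-++ f (elems (S zero)) _)) eq)

map-concatElems⁻ : (f : Fin N → Fin N) (S S′ : Fin m → Subset N) → (∀ i → ∣ S i ∣ ≡ ∣ S′ i ∣) →
  map f (concatElems S) ≡ concatElems S′ → ∀ i → map f (elems (S i)) ≡ elems (S′ i)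
map-concatElems⁻ f S S′ sizes eq zero    = proj₁ (map-concatElems-split f S S′ (sizes zero) eq)
map-concatElems⁻ f S S′ sizes eq (suc i) = map-concatElems⁻ f (S ∘ suc) (S′ ∘ suc) (sizes ∘ suc)
  (proj₂ (map-concatElems-split f S S′ (sizes zero) eq)) i

disjointFamilies-conjugate : (S S′ : Fin m → Subset N) → PairwiseDisjoint S → PairwiseDisjoint S′ →
  (∀ i → ∣ S i ∣ ≡ ∣ S′ i ∣) → ∃ λ (π : Permutation′ N) → ∀ i → permSet π (S i) ≡ S′ i
disjointFamilies-conjugate S S′ disjoint disjoint′ sizes
  with Unique-conjugate (concatElems-Unique S disjoint) (concatElems-Unique S′ disjoint′)
         (length-concatElems-cong S S′ sizes)
... | π , eq = π , λ i → permSet-elems π {S i} {S′ i} (map-concatElems⁻ (π ⟨$⟩ʳ_) S S′ sizes eq i)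

module _ {N r : ℕ} (k : ℕ) where
  open Incidence {N} {r} k

  permAct-incident : (π : Permutation′ N) {x y : Raw N r} →
    Incident x y → Incident (permAct π x) (permAct π y)
  permAct-incident π (inj₁ refl) = inj₁ refl
  permAct-incident π {_ , s} {_ , t} (inj₂ (i≢j , s∩t≡∅)) =
    inj₂ (i≢j , trans (sym (permSet-∩ π s t)) (trans (cong (permSet π) s∩t≡∅) (permSet-∅ π)))

  permAct-inverseˡ : (π : Permutation′ N) (x : Raw N r) → permAct (flip π) (permAct π x) ≡ x
  permAct-inverseˡ π (i , s) = cong (i ,_) (permSet-inverseˡ π s)

  permAct-isTPAut : (π : Permutation′ N) → IsTPAut (permAct π)
  permAct-isTPAut π = record
    { inv       = permAct (flip π)
    ; g-elem    = λ (_ , s) ∣s∣≡k → trans (∣permSet∣ π s) ∣s∣≡k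
    ; inv-elem  = λ (_ , s) ∣s∣≡k → trans (∣permSet∣ (flip π) s) ∣s∣≡k
    ; inv-g     = λ x _ → permAct-inverseˡ π x
    ; g-inv     = λ x _ → permAct-inverseˡ (flip π) x
    ; type-pres = λ _ _ → refl
    ; inc-pres  = λ x y _ _ → mk⇔ (permAct-incident π)
        (subst₂ Incident (permAct-inverseˡ π x) (permAct-inverseˡ π y) ∘ permAct-incident (flip π))
    }

  flag-type-unique : {F : ElemSet} → IsFlag F → ∀ {i s t} → F (i , s) → F (i , t) → s ≡ t
  flag-type-unique (_ , incident) Fs Ft with incident _ _ Fs Ft
  ... | inj₁ refl      = refl
  ... | inj₂ (i≢i , _) = ⊥-elim (i≢i refl)

  flag-types-disjoint : {F : ElemSet} → IsFlag F → ∀ {i j s t x} →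
    F (i , s) → F (j , t) → i ≢ j → x ∈ s → x ∈ t → ⊥
  flag-types-disjoint (_ , incident) Fs Ft i≢j x∈s x∈t with incident _ _ Fs Ft
  ... | inj₁ refl         = i≢j refl
  ... | inj₂ (_ , s∩t≡∅) = ∉⊥ (subst (_ ∈_) s∩t≡∅ (x∈p∩q⁺ (x∈s , x∈t)))

  data TypeMatch (F F′ : ElemSet) (i : Fin r) : Set where
    both    : ∀ {s s′} → F (i , s) → F′ (i , s′) → TypeMatch F F′ i
    neither : ¬ (∃ λ s → F (i , s)) → ¬ (∃ λ s → F′ (i , s)) → TypeMatch F F′ i

  module _ {F F′ : ElemSet} {i : Fin r} where

    swapMatch : TypeMatch F F′ i → TypeMatch F′ F i
    swapMatch (both Fs F′s′)  = both F′s′ Fs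
    swapMatch (neither ¬F ¬F′) = neither ¬F′ ¬F

    -- ∅ stands for a type occurring in neither flag.
    block : TypeMatch F F′ i → Subset N
    block (both {s} _ _) = s
    block (neither _ _)  = ∅

    ∈-block : (μ : TypeMatch F F′ i) {x : Fin N} → x ∈ block μ → ∃ λ s → F (i , s) × x ∈ s
    ∈-block (both Fs _)   x∈ = _ , Fs , x∈
    ∈-block (neither _ _) x∈ = ⊥-elim (∉⊥ x∈)

  module _ {F F′ : ElemSet} {i : Fin r} where

    ∣block∣-swapMatch : IsFlag F → IsFlag F′ → (μ : TypeMatch F F′ i) → ∣ block μ ∣ ≡ ∣ block (swapMatch μ) ∣
    ∣block∣-swapMatch (elem , _) (elem′ , _) (both Fs F′s′) = trans (elem _ Fs) (sym (elem′ _ F′s′))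
    ∣block∣-swapMatch _          _           (neither _ _)  = refl

    ⊆-image-of-block : IsFlag F′ → (π : Permutation′ N) (μ : TypeMatch F F′ i) →
      permSet π (block μ) ≡ block (swapMatch μ) → ∀ {s} → F′ (i , s) → Image (permAct π) F (i , s)
    ⊆-image-of-block flag′ π (both {t} Ft F′t′) eq F′s =
      (i , t) , Ft , cong (i ,_) (trans eq (flag-type-unique flag′ F′t′ F′s))
    ⊆-image-of-block _ _ (neither _ ¬F′) _ F′s = ⊥-elim (¬F′ (_ , F′s))

    image-of-block-⊆ : IsFlag F → (π : Permutation′ N) (μ : TypeMatch F F′ i) →
      permSet π (block μ) ≡ block (swapMatch μ) → ∀ {s} → Image (permAct π) F (i , s) → F′ (i , s)
    image-of-block-⊆ flag π (both Ft F′t′) eq ((_ , u) , Fu , refl) =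
      subst (λ v → F′ (i , v)) (sym (trans (cong (permSet π) (flag-type-unique flag Fu Ft)) eq)) F′t′
    image-of-block-⊆ _ _ (neither ¬F _) _ ((_ , u) , Fu , refl) = ⊥-elim (¬F (u , Fu))

  blocks-disjoint : {F F′ : ElemSet} → IsFlag F → (μ : ∀ i → TypeMatch F F′ i) → PairwiseDisjoint (block ∘ μ)
  blocks-disjoint flag μ {i} {j} i≢j x∈ᵢ x∈ⱼ with ∈-block (μ i) x∈ᵢ | ∈-block (μ j) x∈ⱼ
  ... | _ , Fs , x∈s | _ , Ft , x∈t = flag-types-disjoint flag Fs Ft i≢j x∈s x∈t

  flags-conjugate : {F F′ : ElemSet} → IsFlag F → IsFlag F′ → (∀ i → TypeMatch F F′ i) →
    ∃ λ (π : Permutation′ N) → ∀ x → F′ x ⇔ Image (permAct π) F x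
  flags-conjugate flag flag′ μ
    with disjointFamilies-conjugate (block ∘ μ) (block ∘ swapMatch ∘ μ)
           (blocks-disjoint flag μ) (blocks-disjoint flag′ (swapMatch ∘ μ)) (∣block∣-swapMatch flag flag′ ∘ μ)
  ... | π , eq = π , λ (i , _) →
    mk⇔ (⊆-image-of-block flag′ π (μ i) (eq i)) (image-of-block-⊆ flag π (μ i) (eq i))

  HasType-match : {F F′ : ElemSet} {J : Subset r} → HasType F J → HasType F′ J → ∀ i → TypeMatch F F′ i
  HasType-match {J = J} type type′ i with i ∈? J
  ... | yes i∈J = both (proj₂ (Equivalence.to (type i) i∈J)) (proj₂ (Equivalence.to (type′ i) i∈J))
  ... | no  i∉J = neither (i∉J ∘ Equivalence.from (type i)) (i∉J ∘ Equivalence.from (type′ i))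

lemma4p3 : (n k r : ℕ) → 1 ≤ k → 2 * k + 1 ≤ n → 2 ≤ r →
    let open Incidence {omegaSize n k r} {r} k in
    (∀ (C C′ : ElemSet) → IsChamber C → IsChamber C′ →
      ∃ λ (π : Permutation′ (omegaSize n k r)) → ∀ x → C′ x ⇔ Image (permAct π) C x)
    × FlagTransitive
lemma4p3 n k r _ _ _ = chamber-transitive , flag-transitive
  where
  open Incidence {omegaSize n k r} {r} k
  chamber-transitive : ∀ (C C′ : ElemSet) → IsChamber C → IsChamber C′ →
    ∃ λ (π : Permutation′ (omegaSize n k r)) → ∀ x → C′ x ⇔ Image (permAct π) C x
  chamber-transitive C C′ (flag , full) (flag′ , full′) =
    flags-conjugate k flag flag′ (λ i → both (proj₂ (full i)) (proj₂ (full′ i)))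
  flag-transitive : FlagTransitive
  flag-transitive J F F′ (flag , type) (flag′ , type′)
    with flags-conjugate k flag flag′ (HasType-match k type type′)
  ... | π , F′≡πF = permAct π , permAct-isTPAut k π , F′≡πF
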